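{- Let $w$ be a partial permutation and $P$ a pipe dream with $\delta(P)=\tilde w$. Then every cross of $P$ lies in some reduced pipe dream $D$ with $\delta(D)=\tilde w$; that is, the crosses of $P$ lie in the union of all reduced pipe dreams for $w$.
   Context: A $k\times\ell$ partial permutation is a $0/1$ matrix with at most one $1$ in each row and column; $\tilde w\in S_\infty$ is its unique minimal-length completion to a permutation matrix having $w$ as its upper-left $k\times\ell$ corner. A pipe dream is a finite set of boxes (crosses) in a grid, the remaining boxes being elbow tiles, forming a network of pipes. Its word lists $s_{i+j-1}$ for each cross in row $i$, column $j$, reading each row right to left, rows top to bottom. Its Demazure product $\delta(P)\in S_\infty$ is the product of the word computed with $s_i^2=s_i$ and the braid relations (equivalently, starting from the identity, multiply on the right by each successive $s_i$ only if this increases length). $P$ is reduced if no two pipes cross more than once (equivalently, the number of crosses equals $l(\delta(P))$). Reduced pipe dreams for $w$ are reduced pipe dreams $D$ with $\delta(D)=\tilde w$. -}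

module Defs where

open import Data.Nat using (ℕ; zero; suc; _+_; _∸_; _<_; _≤_; _<ᵇ_; _⊔_)
open import Data.Nat.Properties using () renaming (_≟_ to _≟ℕ_)
open import Data.Bool using (Bool; true; false; if_then_else_)
open import Data.Fin using (Fin; toℕ)
open import Data.List using (List; []; _∷_; map; concatMap; upTo; reverse; foldl; foldr; length)
open import Data.Nat.ListAction using (sum)
open import Data.List.Relation.Unary.All using (All)
open import Data.Product using (Σ; _×_; _,_; proj₁; proj₂; ∃)
open import Data.Product.Properties using (≡-dec)
open import Relation.Nullary using (yes; no; does)
open import Relation.Binary.PropositionalEquality using (_≡_)

-- Permutations of {1,2,...} as functions ℕ → ℕ (0 is an unused dummy
-- point).  s i (i ≥ 1) is the simple transposition swapping i and i+1.

Fn : Set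
Fn = ℕ → ℕ

idF : Fn
idF n = n

swap : ℕ → Fn
swap i n with does (n ≟ℕ i) | does (n ≟ℕ suc i)
... | true  | _     = suc i
... | false | true  = i
... | false | false = n

_·s_ : Fn → ℕ → Fn
(f ·s i) n = f (swap i n)

-- the list a+1, ..., B
rangeFrom : ℕ → ℕ → List ℕ
rangeFrom a B = map (λ t → a + suc t) (upTo (B ∸ a))

range1 : ℕ → List ℕ
range1 B = rangeFrom 0 B

invCount : ℕ → Fn → ℕ
invCount B f = sum (map (λ a → sum (map (λ b → if f b <ᵇ f a then 1 else 0) (rangeFrom a B))) (range1 B))

maxList : List ℕ → ℕ
maxList = foldr _⊔_ 0

-- All intermediate permutations are supported in
-- {1, ..., maxList word + 1}, so the length is the inversion count in
-- that window.

demBound : List ℕ → ℕ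
demBound ws = suc (maxList ws)

demStep : ℕ → Fn → ℕ → Fn
demStep B f i = if invCount B f <ᵇ invCount B (f ·s i) then f ·s i else f

demazure : List ℕ → Fn
demazure ws = foldl (demStep (demBound ws)) idF ws

-- Pipe dreams: finite sets of boxes (i , j) (row i ≥ 1, column j ≥ 1),
-- the crosses; given as a list (only membership matters).

Box : Set
Box = ℕ × ℕ

PipeDream : Set
PipeDream = List Box

WF : PipeDream → Set
WF P = All (λ b → (1 ≤ proj₁ b) × (1 ≤ proj₂ b)) P

memb : Box → PipeDream → Bool
memb b [] = false
memb b (c ∷ P) with does (≡-dec _≟ℕ_ _≟ℕ_ b c)
... | true  = true
... | false = memb b P

word : PipeDream → List ℕ
word P = concatMap (λ i → concatMap (λ j → if memb (i , j) P then (i + j ∸ 1) ∷ [] else [])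
                                     (reverse (range1 (maxList (map proj₂ P)))))
                   (range1 (maxList (map proj₁ P)))

δ : PipeDream → Fn
δ P = demazure (word P)

Reduced : PipeDream → Set
Reduced P = length (word P) ≡ invCount (demBound (word P)) (δ P)

record SInf : Set where
  field
    fun       : Fn
    bound     : ℕ
    fix0      : fun 0 ≡ 0
    fixBeyond : ∀ n → bound < n → fun n ≡ n
    inj       : ∀ a b → fun a ≡ fun b → a ≡ b
    surj      : ∀ m → ∃ λ n → fun n ≡ m
open SInf public

-- Coxeter length = number of inversions (all inversions lie in 1..bound)
len : SInf → ℕ
len v = invCount (bound v) (fun v)

record PartialPerm (k l : ℕ) : Set where
  field
    M        : Fin k → Fin l → Bool
    rowOne   : ∀ r c c' → M r c ≡ true → M r c' ≡ true → c ≡ c'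
    colOne   : ∀ r r' c → M r c ≡ true → M r' c ≡ true → r ≡ r'
open PartialPerm public

-- the permutation matrix of v has a 1 in row i, column v(i); v completes w
-- if its upper-left k × ℓ corner equals w
IsCompletion : ∀ {k l} → PartialPerm k l → SInf → Set
IsCompletion w v = ∀ r c →
  (M w r c ≡ true → fun v (suc (toℕ r)) ≡ suc (toℕ c)) ×
  (fun v (suc (toℕ r)) ≡ suc (toℕ c) → M w r c ≡ true)

IsMinCompletion : ∀ {k l} → PartialPerm k l → SInf → Set
IsMinCompletion w v = IsCompletion w v × (∀ u → IsCompletion w u → len v ≤ len u)

-- Read the crosses of P in the order in which its word lists them. The Demazure product of a
-- word is the ordinary product of a reduced subword, and that subword can be made to pass
-- through any prescribed letter c: keep ascents greedily up to c; if c is a descent of the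
-- product u reached so far, the exchange property deletes one kept letter so that the shorter
-- word followed by c multiplies to u again; then continue greedily. The crosses of such a
-- subword form a pipe dream whose word is exactly that subword, so it is reduced and has the
-- same Demazure product.

{-# OPTIONS --safe #-}
module Submission where

open import Defs
open import Data.Bool using (Bool; true; false; if_then_else_; T)
open import Data.Empty using (⊥-elim)
open import Data.List using (List; []; _∷_; _++_; [_]; map; foldl; length; concatMap; reverse; applyUpTo; applyDownFrom; cartesianProduct; filterᵇ)
open import Data.List.Properties using (map-++; map-∘; map-cong; foldl-++; length-map; length-++; map-id-local; ++-assoc; map-applyUpTo; concatMap-++; concatMap-map; applyDownFrom-∷ʳ; unfold-reverse; foldr-preservesᵇ)
open import Data.List.Membership.Propositional using (_∈_)
open import Data.List.Membership.Propositional.Properties using (∈-∃++; ∈-++⁺ˡ; ∈-++⁺ʳ; ∈-map⁺; ∈-map⁻; ∈-filter⁺; ∈-filter⁻; ∈-cartesianProduct⁺; ∈-applyUpTo⁺; ∈-applyDownFrom⁺)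
open import Data.List.Relation.Unary.All as All using (All; []; _∷_)
import Data.List.Relation.Unary.All.Properties as All
open import Data.List.Relation.Unary.Any using (here; there)
open import Data.List.Relation.Unary.AllPairs using ([]; _∷_)
open import Data.List.Relation.Unary.Unique.Propositional using (Unique)
import Data.List.Relation.Unary.Unique.Propositional.Properties as Unique
open import Data.List.Relation.Binary.Sublist.Propositional using (_⊆_; []; _∷_; _∷ʳ_; ⊆-refl; ⊆-trans)
open import Data.List.Relation.Binary.Sublist.Propositional.Properties as Sublist using (Any-resp-⊆; All-resp-⊆; filter-⊆; []⊆-universal)
import Data.List.Relation.Binary.Permutation.Propositional as ↭
import Data.List.Relation.Binary.Permutation.Propositional.Properties as Perm
open import Data.Nat using (ℕ; zero; suc; _+_; _∸_; _<_; _≤_; _≤′_; _<ᵇ_; _≡ᵇ_; z≤n; s≤s; s≤s⁻¹; z<s; ≤′-refl; ≤′-step)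
open import Data.Nat.Properties
open import Data.Nat.ListAction using (sum)
open import Data.Nat.ListAction.Properties using (sum-↭)
open import Data.Nat.Solver using (module +-*-Solver)
open import Data.Product using (Σ; ∃; _×_; _,_; proj₁; proj₂)
open import Data.Product.Properties using (≡-dec)
open import Data.Unit using (⊤; tt)
open import Function using (_∘_; id)
open import Function.Definitions using (Injective)
open import Relation.Binary.Definitions using (tri<; tri≈; tri>)
open import Relation.Binary.PropositionalEquality hiding ([_])
open import Relation.Nullary using (yes; no)
open import Relation.Nullary.Decidable using (T?)

-- Simple transpositions

-- Indexed by the value of swap i n, so that matching on it after abstracting swap i n
-- also rewrites that value.
data SwapCase (i n : ℕ) : ℕ → Set where
  left  : n ≡ i → SwapCase i n (suc i)
  right : n ≡ suc i → SwapCase i n i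
  fixed : n ≢ i → n ≢ suc i → SwapCase i n n

swapCase : ∀ i n → SwapCase i n (swap i n)
swapCase i n with n ≡ᵇ i in n≡ᵇi | n ≡ᵇ suc i in n≡ᵇ1+i
... | true  | _     = left (≡ᵇ⇒≡ n i (subst T (sym n≡ᵇi) tt))
... | false | true  = right (≡ᵇ⇒≡ n (suc i) (subst T (sym n≡ᵇ1+i) tt))
... | false | false = fixed (λ n≡i → subst T n≡ᵇi (≡⇒≡ᵇ n i n≡i))
                           (λ n≡1+i → subst T n≡ᵇ1+i (≡⇒≡ᵇ n (suc i) n≡1+i))

swap-left : ∀ i → swap i i ≡ suc i
swap-left i with swap i i | swapCase i i
... | _ | left _      = refl
... | _ | right i≡1+i = ⊥-elim (1+n≢n (sym i≡1+i))
... | _ | fixed i≢i _ = ⊥-elim (i≢i refl)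

swap-right : ∀ i → swap i (suc i) ≡ i
swap-right i with swap i (suc i) | swapCase i (suc i)
... | _ | left 1+i≡i      = ⊥-elim (1+n≢n 1+i≡i)
... | _ | right _         = refl
... | _ | fixed _ 1+i≢1+i = ⊥-elim (1+i≢1+i refl)

swap-outside : ∀ i {n} → n ≢ i → n ≢ suc i → swap i n ≡ n
swap-outside i {n} n≢i n≢1+i with swap i n | swapCase i n
... | _ | left n≡i    = ⊥-elim (n≢i n≡i)
... | _ | right n≡1+i = ⊥-elim (n≢1+i n≡1+i)
... | _ | fixed _ _   = refl

swap-involutive : ∀ i n → swap i (swap i n) ≡ n
swap-involutive i n with swap i n | swapCase i n
... | _ | left refl  = swap-right i
... | _ | right refl = swap-left i
... | _ | fixed n≢i n≢1+i = swap-outside i n≢i n≢1+i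

swap-injective : ∀ i → Injective _≡_ _≡_ (swap i)
swap-injective i {a} {b} e = trans (sym (swap-involutive i a)) (trans (cong (swap i) e) (swap-involutive i b))

swap-inversion : ∀ r {x y} → x < y → swap r y < swap r x → x ≡ r × y ≡ suc r
swap-inversion r {x} {y} x<y h with swap r x | swapCase r x | swap r y | swapCase r y
... | _ | left refl  | _ | left refl  = ⊥-elim (<-irrefl refl x<y)
... | _ | left refl  | _ | right refl = refl , refl
... | _ | left refl  | _ | fixed _ _  = ⊥-elim (<⇒≱ x<y (s≤s⁻¹ h))
... | _ | right refl | _ | left refl  = ⊥-elim (<⇒≱ x<y (n≤1+n r))
... | _ | right refl | _ | right refl = ⊥-elim (<-irrefl refl x<y)
... | _ | right refl | _ | fixed _ _  = ⊥-elim (<-asym (<-trans (n<1+n r) x<y) h)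
... | _ | fixed _ _  | _ | left refl  = ⊥-elim (<-asym (<-trans (n<1+n r) h) x<y)
... | _ | fixed _ _  | _ | right refl = ⊥-elim (<⇒≱ h (s≤s⁻¹ x<y))
... | _ | fixed _ _  | _ | fixed _ _  = ⊥-elim (<-asym x<y h)

swap∘≗·s : ∀ {v r s} → Injective _≡_ _≡_ v → v s ≡ r → v (suc s) ≡ suc r → swap r ∘ v ≗ v ·s s
swap∘≗·s {v} {r} {s} inj vs≡r v1+s≡1+r n with swap s n | swapCase s n
... | _ | left refl  = trans (cong (swap r) vs≡r) (trans (swap-left r) (sym v1+s≡1+r))
... | _ | right refl = trans (cong (swap r) v1+s≡1+r) (trans (swap-right r) (sym vs≡r))
... | _ | fixed n≢s n≢1+s =
  swap-outside r (λ e → n≢s (inj (trans e (sym vs≡r)))) (λ e → n≢1+s (inj (trans e (sym v1+s≡1+r))))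

·s-injective : ∀ {f} i → Injective _≡_ _≡_ f → Injective _≡_ _≡_ (f ·s i)
·s-injective i inj = swap-injective i ∘ inj

-- Inversion counts

bit : Bool → ℕ
bit b = if b then 1 else 0

<ᵇ-true : ∀ {m n} → m < n → (m <ᵇ n) ≡ true
<ᵇ-true {m} {n} m<n with m <ᵇ n in e
... | true  = refl
... | false = ⊥-elim (subst T e (<⇒<ᵇ m<n))

<ᵇ-false : ∀ {m n} → n ≤ m → (m <ᵇ n) ≡ false
<ᵇ-false {m} {n} n≤m with m <ᵇ n in e
... | false = refl
... | true  = ⊥-elim (<⇒≱ (<ᵇ⇒< m n (subst T (sym e) tt)) n≤m)

interval : ℕ → ℕ → List ℕ
interval lo zero    = []
interval lo (suc n) = lo ∷ interval (suc lo) n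

interval-++ : ∀ lo m n → interval lo (m + n) ≡ interval lo m ++ interval (lo + m) n
interval-++ lo zero    n = cong (λ lo′ → interval lo′ n) (sym (+-identityʳ lo))
interval-++ lo (suc m) n = cong (lo ∷_) (trans (interval-++ (suc lo) m n) (cong (λ lo′ → interval (suc lo) m ++ interval lo′ n) (sym (+-suc lo m))))

interval-lower : ∀ {x} lo n → x ∈ interval lo n → lo ≤ x
interval-lower lo (suc n) (here refl) = ≤-refl
interval-lower lo (suc n) (there x∈) = <⇒≤ (interval-lower (suc lo) n x∈)

interval-upper : ∀ {x} lo n → x ∈ interval lo n → x < lo + n
interval-upper lo (suc n) (here refl) = m<m+n lo z<s
interval-upper {x} lo (suc n) (there x∈) = subst (x <_) (sym (+-suc lo n)) (interval-upper (suc lo) n x∈)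

applyUpTo-interval : ∀ {h lo} n → (∀ t → h t ≡ lo + t) → applyUpTo h n ≡ interval lo n
applyUpTo-interval {lo = lo} zero    h≗lo+ = refl
applyUpTo-interval {lo = lo} (suc n) h≗lo+ =
  cong₂ _∷_ (trans (h≗lo+ 0) (+-identityʳ lo)) (applyUpTo-interval n (λ t → trans (h≗lo+ (suc t)) (+-suc lo t)))

rangeFrom-interval : ∀ a B → rangeFrom a B ≡ interval (suc a) (B ∸ a)
rangeFrom-interval a B = trans (map-applyUpTo id (λ t → a + suc t) (B ∸ a)) (applyUpTo-interval (B ∸ a) (+-suc a))

rowInversions : Fn → ℕ → List ℕ → ℕ
rowInversions f a bs = sum (map (λ b → bit (f b <ᵇ f a)) bs)

inversions : Fn → List ℕ → ℕ
inversions f []       = 0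
inversions f (a ∷ bs) = rowInversions f a bs + inversions f bs

invCount≡inversions : ∀ B f → invCount B f ≡ inversions f (interval 1 B)
invCount≡inversions B f = trans (cong rows (rangeFrom-interval 0 B)) (tails 0 B refl)
  where
  rows : List ℕ → ℕ
  rows as = sum (map (λ a → rowInversions f a (rangeFrom a B)) as)
  tails : ∀ lo n → lo + n ≡ B → rows (interval (suc lo) n) ≡ inversions f (interval (suc lo) n)
  tails lo zero    _ = refl
  tails lo (suc n) e = cong₂ _+_ (cong (rowInversions f (suc lo)) rangeFrom≡interval)
                                 (tails (suc lo) n (trans (sym (+-suc lo n)) e))
    where
    rangeFrom≡interval : rangeFrom (suc lo) B ≡ interval (2 + lo) n
    rangeFrom≡interval = trans (rangeFrom-interval (suc lo) B)
      (cong (interval (2 + lo)) (trans (cong (_∸ suc lo) (trans (sym e) (+-suc lo n))) (m+n∸m≡n lo n)))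

inversions-map : ∀ f σ as → inversions (f ∘ σ) as ≡ inversions f (map σ as)
inversions-map f σ []       = refl
inversions-map f σ (a ∷ as) = cong₂ _+_ (cong sum (map-∘ as)) (inversions-map f σ as)

inversions-cong : ∀ {f g} → f ≗ g → ∀ as → inversions f as ≡ inversions g as
inversions-cong f≗g []       = refl
inversions-cong f≗g (a ∷ as) =
  cong₂ _+_ (cong sum (map-cong (λ b → cong₂ (λ x y → bit (x <ᵇ y)) (f≗g b) (f≗g a)) as)) (inversions-cong f≗g as)

inversions-swap : ∀ f ps x y qs → inversions f (ps ++ x ∷ y ∷ qs) + bit (f x <ᵇ f y)
                                ≡ inversions f (ps ++ y ∷ x ∷ qs) + bit (f y <ᵇ f x)
inversions-swap f [] x y qs =
  solve 5 (λ yx xy rx ry r → ((yx :+ rx) :+ (ry :+ r)) :+ xy := ((xy :+ ry) :+ (rx :+ r)) :+ yx) refl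
    (bit (f y <ᵇ f x)) (bit (f x <ᵇ f y)) (rowInversions f x qs) (rowInversions f y qs) (inversions f qs)
  where open +-*-Solver
inversions-swap f (p ∷ ps) x y qs = begin
  (rowInversions f p (ps ++ x ∷ y ∷ qs) + inversions f (ps ++ x ∷ y ∷ qs)) + bit (f x <ᵇ f y)
    ≡⟨ +-assoc (rowInversions f p (ps ++ x ∷ y ∷ qs)) _ _ ⟩
  rowInversions f p (ps ++ x ∷ y ∷ qs) + (inversions f (ps ++ x ∷ y ∷ qs) + bit (f x <ᵇ f y))
    ≡⟨ cong₂ _+_ (sum-↭ (Perm.map⁺ _ (Perm.++⁺ˡ ps (↭.swap x y ↭.refl)))) (inversions-swap f ps x y qs) ⟩
  rowInversions f p (ps ++ y ∷ x ∷ qs) + (inversions f (ps ++ y ∷ x ∷ qs) + bit (f y <ᵇ f x))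
    ≡⟨ +-assoc (rowInversions f p (ps ++ y ∷ x ∷ qs)) _ _ ⟨
  (rowInversions f p (ps ++ y ∷ x ∷ qs) + inversions f (ps ++ y ∷ x ∷ qs)) + bit (f y <ᵇ f x) ∎
  where open ≡-Reasoning

invCount-cong : ∀ B {f g} → f ≗ g → invCount B f ≡ invCount B g
invCount-cong B {f} {g} f≗g =
  trans (invCount≡inversions B f) (trans (inversions-cong f≗g (interval 1 B)) (sym (invCount≡inversions B g)))

rowInversions-≤ : ∀ f a {bs} → All (λ b → f a ≤ f b) bs → rowInversions f a bs ≡ 0
rowInversions-≤ f a []              = refl
rowInversions-≤ f a (fa≤fb ∷ fa≤fbs) rewrite <ᵇ-false fa≤fb = rowInversions-≤ f a fa≤fbs

invCount-id : ∀ B → invCount B id ≡ 0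
invCount-id B = trans (invCount≡inversions B id) (sorted 1 B)
  where
  sorted : ∀ lo n → inversions id (interval lo n) ≡ 0
  sorted lo zero    = refl
  sorted lo (suc n) = cong₂ _+_ (rowInversions-≤ id lo (All.tabulate (<⇒≤ ∘ interval-lower (suc lo) n))) (sorted (suc lo) n)

Valid : ℕ → ℕ → Set
Valid B i = 1 ≤ i × suc i ≤ B

interval-split : ∀ {B i} → Valid B i →
                 ∃ λ ps → ∃ λ qs → interval 1 B ≡ ps ++ i ∷ suc i ∷ qs × map (swap i) (interval 1 B) ≡ ps ++ suc i ∷ i ∷ qs
interval-split {B} {suc i} (_ , 2+i≤B) with m≤n⇒∃[o]m+o≡n 2+i≤B
... | m , refl = interval 1 i , interval (3 + i) m , split , swapped
  where
  split : interval 1 (2 + i + m) ≡ interval 1 i ++ suc i ∷ 2 + i ∷ interval (3 + i) m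
  split = trans (cong (interval 1) (sym (trans (+-suc i (suc m)) (cong suc (+-suc i m))))) (interval-++ 1 i (2 + m))
  below : All (λ x → swap (suc i) x ≡ x) (interval 1 i)
  below = All.tabulate λ x∈ → let x<1+i = interval-upper 1 i x∈ in
    swap-outside (suc i) (<⇒≢ x<1+i) (<⇒≢ (m<n⇒m<1+n x<1+i))
  above : All (λ x → swap (suc i) x ≡ x) (interval (3 + i) m)
  above = All.tabulate λ x∈ → let 2+i<x = interval-lower (3 + i) m x∈ in
    swap-outside (suc i) (>⇒≢ (<-trans (n<1+n (suc i)) 2+i<x)) (>⇒≢ 2+i<x)
  swapped : map (swap (suc i)) (interval 1 (2 + i + m)) ≡ interval 1 i ++ 2 + i ∷ suc i ∷ interval (3 + i) m
  swapped = trans (cong (map (swap (suc i))) split)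
    (trans (map-++ (swap (suc i)) (interval 1 i) _)
           (cong₂ _++_ (map-id-local below) (cong₂ _∷_ (swap-left (suc i)) (cong₂ _∷_ (swap-right (suc i)) (map-id-local above)))))

invCount-·s : ∀ B f {i} → Valid B i →
              invCount B f + bit (f i <ᵇ f (suc i)) ≡ invCount B (f ·s i) + bit (f (suc i) <ᵇ f i)
invCount-·s B f {i} valid with interval-split valid
... | ps , qs , split , swapped = begin
  invCount B f + bit (f i <ᵇ f (suc i))
    ≡⟨ cong (_+ _) (trans (invCount≡inversions B f) (cong (inversions f) split)) ⟩
  inversions f (ps ++ i ∷ suc i ∷ qs) + bit (f i <ᵇ f (suc i))
    ≡⟨ inversions-swap f ps i (suc i) qs ⟩
  inversions f (ps ++ suc i ∷ i ∷ qs) + bit (f (suc i) <ᵇ f i)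
    ≡⟨ cong (_+ _) (trans (inversions-map f (swap i) (interval 1 B)) (cong (inversions f) swapped)) ⟨
  inversions (f ·s i) (interval 1 B) + bit (f (suc i) <ᵇ f i)
    ≡⟨ cong (_+ _) (invCount≡inversions B (f ·s i)) ⟨
  invCount B (f ·s i) + bit (f (suc i) <ᵇ f i) ∎
  where open ≡-Reasoning

invCount-ascent : ∀ B f {i} → Valid B i → f i < f (suc i) → invCount B (f ·s i) ≡ suc (invCount B f)
invCount-ascent B f {i} valid ascent = begin
  invCount B (f ·s i)                           ≡⟨ +-identityʳ _ ⟨
  invCount B (f ·s i) + 0                       ≡⟨ cong (λ b → invCount B (f ·s i) + bit b) (<ᵇ-false (<⇒≤ ascent)) ⟨
  invCount B (f ·s i) + bit (f (suc i) <ᵇ f i)  ≡⟨ invCount-·s B f valid ⟨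
  invCount B f + bit (f i <ᵇ f (suc i))         ≡⟨ cong (λ b → invCount B f + bit b) (<ᵇ-true ascent) ⟩
  invCount B f + 1                              ≡⟨ +-comm _ 1 ⟩
  suc (invCount B f)                            ∎
  where open ≡-Reasoning

invCount-descent : ∀ B f {i} → Valid B i → f (suc i) < f i → invCount B f ≡ suc (invCount B (f ·s i))
invCount-descent B f {i} valid descent =
  trans (invCount-cong B (λ n → cong f (sym (swap-involutive i n))))
        (invCount-ascent B (f ·s i) valid (subst₂ _<_ (cong f (sym (swap-left i))) (cong f (sym (swap-right i))) descent))

invCount-·s-≤ : ∀ B f {i} → Valid B i → invCount B (f ·s i) ≤ suc (invCount B f)
invCount-·s-≤ B f {i} valid = begin
  invCount B (f ·s i)                           ≤⟨ m≤m+n _ _ ⟩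
  invCount B (f ·s i) + bit (f (suc i) <ᵇ f i)  ≡⟨ invCount-·s B f valid ⟨
  invCount B f + bit (f i <ᵇ f (suc i))         ≤⟨ +-monoʳ-≤ (invCount B f) (bit≤1 (f i <ᵇ f (suc i))) ⟩
  invCount B f + 1                              ≡⟨ +-comm _ 1 ⟩
  suc (invCount B f)                            ∎
  where
  open ≤-Reasoning
  bit≤1 : ∀ b → bit b ≤ 1
  bit≤1 true  = ≤-refl
  bit≤1 false = z≤n

invCount-<ᵇ : ∀ B f {i} → Valid B i → f i ≢ f (suc i) → (invCount B f <ᵇ invCount B (f ·s i)) ≡ (f i <ᵇ f (suc i))
invCount-<ᵇ B f {i} valid fi≢f1+i with <-cmp (f i) (f (suc i))
... | tri< ascent _ _ = trans (<ᵇ-true (≤-reflexive (sym (invCount-ascent B f valid ascent)))) (sym (<ᵇ-true ascent))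
... | tri≈ _ fi≡f1+i _ = ⊥-elim (fi≢f1+i fi≡f1+i)
... | tri> _ _ descent = trans (<ᵇ-false (≤-trans (n≤1+n _) (≤-reflexive (sym (invCount-descent B f valid descent)))))
                               (sym (<ᵇ-false (<⇒≤ descent)))

-- Demazure products

infixl 5 _·w_ _⋆s_ _⋆w_

_·w_ : Fn → List ℕ → Fn
f ·w ws = foldl _·s_ f ws

-- demStep compares inversion counts in a window; comparing the two values instead is
-- equivalent (demazure≡⋆w) and independent of the window.
_⋆s_ : Fn → ℕ → Fn
f ⋆s i = if f i <ᵇ f (suc i) then f ·s i else f

_⋆w_ : Fn → List ℕ → Fn
f ⋆w ws = foldl _⋆s_ f ws

Ascending : Fn → List ℕ → Set
Ascending f []       = ⊤
Ascending f (i ∷ ws) = f i < f (suc i) × Ascending (f ·s i) ws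

⋆s-ascent : ∀ f i → f i < f (suc i) → f ⋆s i ≡ f ·s i
⋆s-ascent f i ascent = cong (λ b → if b then f ·s i else f) (<ᵇ-true ascent)

⋆s-descent : ∀ f i → f (suc i) < f i → f ⋆s i ≡ f
⋆s-descent f i descent = cong (λ b → if b then f ·s i else f) (<ᵇ-false (<⇒≤ descent))

⋆s-injective : ∀ {f} i → Injective _≡_ _≡_ f → Injective _≡_ _≡_ (f ⋆s i)
⋆s-injective {f} i inj = by (f i <ᵇ f (suc i))
  where
  by : ∀ b → Injective _≡_ _≡_ (if b then f ·s i else f)
  by true  = ·s-injective i inj
  by false = inj

·w-injective : ∀ {f} ws → Injective _≡_ _≡_ f → Injective _≡_ _≡_ (f ·w ws)
·w-injective []       inj = inj
·w-injective (i ∷ ws) inj = ·w-injective ws (·s-injective i inj)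

⋆w-injective : ∀ {f} ws → Injective _≡_ _≡_ f → Injective _≡_ _≡_ (f ⋆w ws)
⋆w-injective []       inj = inj
⋆w-injective (i ∷ ws) inj = ⋆w-injective ws (⋆s-injective i inj)

·w-cong : ∀ {f g} ws → f ≗ g → f ·w ws ≗ g ·w ws
·w-cong []       f≗g = f≗g
·w-cong (i ∷ ws) f≗g = ·w-cong ws (f≗g ∘ swap i)

⋆w-cong : ∀ {f g} ws → f ≗ g → f ⋆w ws ≗ g ⋆w ws
⋆w-cong {f} {g} []       f≗g = f≗g
⋆w-cong {f} {g} (i ∷ ws) f≗g = ⋆w-cong ws ⋆s-cong
  where
  ⋆s-cong : f ⋆s i ≗ g ⋆s i
  ⋆s-cong n with f i <ᵇ f (suc i) | g i <ᵇ g (suc i) | cong₂ _<ᵇ_ (f≗g i) (f≗g (suc i))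
  ... | true  | true  | _ = f≗g (swap i n)
  ... | false | false | _ = f≗g n

∘-·w : ∀ g f ws → (g ∘ f) ·w ws ≡ g ∘ (f ·w ws)
∘-·w g f []       = refl
∘-·w g f (i ∷ ws) = ∘-·w g (f ·s i) ws

Ascending-++⁺ : ∀ {f} xs {ys} → Ascending f xs → Ascending (f ·w xs) ys → Ascending f (xs ++ ys)
Ascending-++⁺ []       _               asc = asc
Ascending-++⁺ (i ∷ xs) (ascent , ascᵢ) asc = ascent , Ascending-++⁺ xs ascᵢ asc

Ascending-cong : ∀ {f g} ws → f ≗ g → Ascending f ws → Ascending g ws
Ascending-cong []       f≗g _              = tt
Ascending-cong (i ∷ ws) f≗g (ascent , asc) =
  subst₂ _<_ (f≗g i) (f≗g (suc i)) ascent , Ascending-cong ws (f≗g ∘ swap i) asc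

demazure≡⋆w : ∀ B {f} ws → Injective _≡_ _≡_ f → All (Valid B) ws → foldl (demStep B) f ws ≡ f ⋆w ws
demazure≡⋆w B []       inj []               = refl
demazure≡⋆w B {f} (i ∷ ws) inj (valid ∷ valids) =
  trans (cong (λ b → foldl (demStep B) (if b then f ·s i else f) ws)
              (invCount-<ᵇ B f valid (λ fi≡f1+i → 1+n≢n (sym (inj fi≡f1+i)))))
        (demazure≡⋆w B ws (⋆s-injective i inj) valids)

⋆w-ascending : ∀ {f} ws → Ascending f ws → f ⋆w ws ≡ f ·w ws
⋆w-ascending []           _              = refl
⋆w-ascending {f} (i ∷ ws) (ascent , asc) = trans (cong (_⋆w ws) (⋆s-ascent f i ascent)) (⋆w-ascending ws asc)

invCount-·w-ascending : ∀ B {f} ws → All (Valid B) ws → Ascending f ws →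
                        invCount B (f ·w ws) ≡ length ws + invCount B f
invCount-·w-ascending B []       []               _              = refl
invCount-·w-ascending B {f} (i ∷ ws) (valid ∷ valids) (ascent , asc) =
  trans (invCount-·w-ascending B ws valids asc) (trans (cong (length ws +_) (invCount-ascent B f valid ascent)) (+-suc _ _))

invCount-·w-≤ : ∀ B {f} ws → All (Valid B) ws → invCount B (f ·w ws) ≤ length ws + invCount B f
invCount-·w-≤ B []       []               = ≤-refl
invCount-·w-≤ B {f} (i ∷ ws) (valid ∷ valids) =
  ≤-trans (invCount-·w-≤ B ws valids) (≤-trans (+-monoʳ-≤ (length ws) (invCount-·s-≤ B f valid)) (≤-reflexive (+-suc _ _)))

ascending-by-invCount : ∀ B {f} ws → Injective _≡_ _≡_ f → All (Valid B) ws →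
                        invCount B (f ·w ws) ≡ length ws + invCount B f → Ascending f ws
ascending-by-invCount B []       inj []               _     = tt
ascending-by-invCount B {f} (i ∷ ws) inj (valid ∷ valids) count with <-cmp (f i) (f (suc i))
... | tri< ascent _ _ = ascent , ascending-by-invCount B ws (·s-injective i inj) valids
        (trans count (trans (sym (+-suc _ _)) (cong (length ws +_) (sym (invCount-ascent B f valid ascent)))))
... | tri≈ _ fi≡f1+i _ = ⊥-elim (1+n≢n (sym (inj fi≡f1+i)))
... | tri> _ _ descent = ⊥-elim (<⇒≱ (s≤s (n≤1+n _)) (begin
  suc (suc (length ws + invCount B (f ·s i)))  ≡⟨ cong suc (+-suc _ _) ⟨
  suc (length ws + suc (invCount B (f ·s i)))  ≡⟨ cong (λ c → suc (length ws + c)) (invCount-descent B f valid descent) ⟨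
  suc (length ws + invCount B f)               ≡⟨ count ⟨
  invCount B ((f ·s i) ·w ws)                  ≤⟨ invCount-·w-≤ B ws valids ⟩
  length ws + invCount B (f ·s i)              ∎))
  where open ≤-Reasoning

-- Reduced subwords

module Subwords {A : Set} (letter : A → ℕ) where

  letters : List A → List ℕ
  letters = map letter

  ·w-++ : ∀ f xs ys → f ·w letters (xs ++ ys) ≡ (f ·w letters xs) ·w letters ys
  ·w-++ f xs ys = trans (cong (f ·w_) (map-++ letter xs ys)) (foldl-++ _·s_ f (letters xs) (letters ys))

  ⋆w-++ : ∀ f xs ys → f ⋆w letters (xs ++ ys) ≡ (f ⋆w letters xs) ⋆w letters ys
  ⋆w-++ f xs ys = trans (cong (f ⋆w_) (map-++ letter xs ys)) (foldl-++ _⋆s_ f (letters xs) (letters ys))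

  Ascending-++ : ∀ {f} xs {ys} → Ascending f (letters xs) → Ascending (f ·w letters xs) (letters ys) →
                 Ascending f (letters (xs ++ ys))
  Ascending-++ {f} xs {ys} ascₓ asc = subst (Ascending f) (sym (map-++ letter xs ys)) (Ascending-++⁺ (letters xs) ascₓ asc)

  record ReducedSubword (f : Fn) (L : List A) (v : Fn) : Set where
    constructor reducedSubword
    field
      subword   : List A
      sublist   : subword ⊆ L
      ascending : Ascending f (letters subword)
      product   : f ·w letters subword ≗ v

  reducedSubword-≗ : ∀ {f L v w} → v ≗ w → ReducedSubword f L v → ReducedSubword f L w
  reducedSubword-≗ v≗w (reducedSubword S S⊆L asc prod) = reducedSubword S S⊆L asc (λ n → trans (prod n) (v≗w n))

  greedySubword : ∀ f L → ReducedSubword f L (f ⋆w letters L)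
  greedySubword f []      = reducedSubword [] [] tt (λ _ → refl)
  greedySubword f (x ∷ L) with f (letter x) <ᵇ f (suc (letter x)) in ascent
  ... | true  = let reducedSubword S S⊆L asc prod = greedySubword (f ·s letter x) L in
                reducedSubword (x ∷ S) (refl ∷ S⊆L) (<ᵇ⇒< _ _ (subst T (sym ascent) tt) , asc) prod
  ... | false = let reducedSubword S S⊆L asc prod = greedySubword f L in
                reducedSubword S (x ∷ʳ S⊆L) asc prod

  ++-reducedSubword : ∀ {f v w L₁ L₂} → ReducedSubword f L₁ v → ReducedSubword v L₂ w → ReducedSubword f (L₁ ++ L₂) w
  ++-reducedSubword {f} (reducedSubword S S⊆L₁ ascS prodS) (reducedSubword U U⊆L₂ ascU prodU) =
    reducedSubword (S ++ U) (Sublist.++⁺ S⊆L₁ U⊆L₂)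
      (Ascending-++ S ascS (Ascending-cong (letters U) (sym ∘ prodS) ascU))
      (λ n → trans (cong-app (·w-++ f S U) n) (trans (·w-cong (letters U) prodS n) (prodU n)))

  -- If the rest of the word already has the descent at s, recurse; otherwise its first letter
  -- created it, and deleting that letter is right multiplication by s (swap∘≗·s).
  exchange : ∀ R s → (id ·w letters R) (suc s) < (id ·w letters R) s →
             ∃ λ R′ → R′ ⊆ R × length R ≡ suc (length R′) × id ·w letters R′ ≗ (id ·w letters R) ·s s
  exchange []      s descent = ⊥-elim (<-asym descent (n<1+n s))
  exchange (r ∷ R) s descent with <-cmp ((id ·w letters R) s) ((id ·w letters R) (suc s))
  ... | tri< ascent _ _ = R , r ∷ʳ ⊆-refl , refl , λ n → sym (begin
      (id ·w letters (r ∷ R)) (swap s n)  ≡⟨ cons (swap s n) ⟩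
      swap ρ (v (swap s n))               ≡⟨ swap∘≗·s (·w-injective (letters R) id) vs≡ρ v1+s≡1+ρ (swap s n) ⟩
      v (swap s (swap s n))               ≡⟨ cong v (swap-involutive s n) ⟩
      v n                                 ∎)
    where
    open ≡-Reasoning
    ρ = letter r
    v = id ·w letters R
    cons : ∀ n → (id ·w letters (r ∷ R)) n ≡ swap ρ (v n)
    cons = cong-app (∘-·w (swap ρ) id (letters R))
    created = swap-inversion ρ ascent (subst₂ _<_ (cons (suc s)) (cons s) descent)
    vs≡ρ = proj₁ created
    v1+s≡1+ρ = proj₂ created
  ... | tri≈ _ vs≡v1+s _ = ⊥-elim (1+n≢n (sym (·w-injective (letters R) id vs≡v1+s)))
  ... | tri> _ _ descentR = let R′ , R′⊆R , |R|≡1+|R′| , prodR′ = exchange R s descentR in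
    r ∷ R′ , refl ∷ R′⊆R , cong suc |R|≡1+|R′| , λ n →
      trans (cong-app (∘-·w (swap (letter r)) id (letters R′)) n)
     (trans (cong (swap (letter r)) (prodR′ n))
            (sym (cong-app (∘-·w (swap (letter r)) id (letters R)) (swap s n))))

  module _ (B : ℕ) (A₁ : List A) (c : A) (valid : All (Valid B ∘ letter) (A₁ ++ [ c ])) where
    private
      s = letter c
      u = id ⋆w letters A₁
      open ReducedSubword (greedySubword id A₁)
        renaming (subword to S; sublist to S⊆A₁; ascending to ascS; product to prodS)

      ReducedPrefix : Set
      ReducedPrefix = Σ (ReducedSubword id (A₁ ++ [ c ]) (id ⋆w letters (A₁ ++ [ c ])))
                        (λ T → c ∈ ReducedSubword.subword T)

      ⋆w-snoc : id ⋆w letters (A₁ ++ [ c ]) ≡ u ⋆s s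
      ⋆w-snoc = ⋆w-++ id A₁ [ c ]

      prefixAtAscent : u s < u (suc s) → ReducedPrefix
      prefixAtAscent ascent =
        reducedSubword (S ++ [ c ]) (Sublist.++⁺ S⊆A₁ ⊆-refl) (Ascending-++ S ascS (ascentS , tt)) product ,
        ∈-++⁺ʳ S (here refl)
        where
        ascentS = subst₂ _<_ (sym (prodS s)) (sym (prodS (suc s))) ascent
        product : id ·w letters (S ++ [ c ]) ≗ id ⋆w letters (A₁ ++ [ c ])
        product n = trans (cong-app (·w-++ id S [ c ]) n)
                          (trans (prodS (swap s n)) (sym (cong-app (trans ⋆w-snoc (⋆s-ascent u s ascent)) n)))

      -- The shortened word followed by c is reduced because its length is that of u.
      prefixAtDescent : u (suc s) < u s → ReducedPrefix
      prefixAtDescent descent with exchange S s (subst₂ _<_ (sym (prodS (suc s))) (sym (prodS s)) descent)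
      ... | S′ , S′⊆S , |S|≡1+|S′| , prodS′ =
        reducedSubword (S′ ++ [ c ]) T⊆ (ascending-by-invCount B (letters (S′ ++ [ c ])) id (validLetters T⊆) count) product ,
        ∈-++⁺ʳ S′ (here refl)
        where
        T⊆ : S′ ++ [ c ] ⊆ A₁ ++ [ c ]
        T⊆ = Sublist.++⁺ (⊆-trans S′⊆S S⊆A₁) ⊆-refl
        validLetters : ∀ {T} → T ⊆ A₁ ++ [ c ] → All (Valid B) (letters T)
        validLetters T⊆ = All.map⁺ (All-resp-⊆ T⊆ valid)
        unchanged : id ·w letters (S′ ++ [ c ]) ≗ id ·w letters S
        unchanged n = trans (cong-app (·w-++ id S′ [ c ]) n)
                            (trans (prodS′ (swap s n)) (cong (id ·w letters S) (swap-involutive s n)))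
        product : id ·w letters (S′ ++ [ c ]) ≗ id ⋆w letters (A₁ ++ [ c ])
        product n = trans (unchanged n) (trans (prodS n) (sym (cong-app (trans ⋆w-snoc (⋆s-descent u s descent)) n)))
        lengths : length (letters S) ≡ length (letters (S′ ++ [ c ]))
        lengths = trans (length-map letter S) (trans |S|≡1+|S′|
                    (sym (trans (length-map letter (S′ ++ [ c ])) (trans (length-++ S′) (+-comm _ 1)))))
        count : invCount B (id ·w letters (S′ ++ [ c ])) ≡ length (letters (S′ ++ [ c ])) + invCount B id
        count = begin
          invCount B (id ·w letters (S′ ++ [ c ]))        ≡⟨ invCount-cong B unchanged ⟩
          invCount B (id ·w letters S)                    ≡⟨ invCount-·w-ascending B (letters S) (validLetters (Sublist.++⁺ʳ [ c ] S⊆A₁)) ascS ⟩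
          length (letters S) + invCount B id              ≡⟨ cong (_+ invCount B id) lengths ⟩
          length (letters (S′ ++ [ c ])) + invCount B id  ∎
          where open ≡-Reasoning

    reducedPrefixThrough : ReducedPrefix
    reducedPrefixThrough with <-cmp (u s) (u (suc s))
    ... | tri< ascent _ _  = prefixAtAscent ascent
    ... | tri≈ _ us≡u1+s _ = ⊥-elim (1+n≢n (sym (⋆w-injective (letters A₁) id us≡u1+s)))
    ... | tri> _ _ descent = prefixAtDescent descent

  reducedSubwordThrough : ∀ B L {c} → c ∈ L → All (Valid B ∘ letter) L →
                          Σ (ReducedSubword id L (id ⋆w letters L)) (λ S → c ∈ ReducedSubword.subword S)
  reducedSubwordThrough B L {c} c∈L valid with ∈-∃++ c∈L
  ... | A₁ , A₂ , refl rewrite sym (++-assoc A₁ [ c ] A₂) =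
    let T , c∈T = reducedPrefixThrough B A₁ c (All.++⁻ˡ (A₁ ++ [ c ]) valid)
        whole = ++-reducedSubword T (greedySubword (id ⋆w letters (A₁ ++ [ c ])) A₂)
    in reducedSubword-≗ (λ n → sym (cong-app (⋆w-++ id (A₁ ++ [ c ]) A₂) n)) whole , ∈-++⁺ˡ c∈T

-- Pipe dreams

⊆-unique-≡ : ∀ {A : Set} {xs ys zs : List A} → Unique zs → xs ⊆ zs → ys ⊆ zs →
             (∀ {x} → x ∈ xs → x ∈ ys) → (∀ {x} → x ∈ ys → x ∈ xs) → xs ≡ ys
⊆-unique-≡ []           []         []         _  _    = refl
⊆-unique-≡ (_ ∷ unique) (z ∷ʳ xs⊆) (.z ∷ʳ ys⊆) to from = ⊆-unique-≡ unique xs⊆ ys⊆ to from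
⊆-unique-≡ (z∉ ∷ _)     (refl ∷ _) (z ∷ʳ ys⊆) to _    = ⊥-elim (All.lookup z∉ (Any-resp-⊆ ys⊆ (to (here refl))) refl)
⊆-unique-≡ (z∉ ∷ _)     (z ∷ʳ xs⊆) (refl ∷ _) _  from = ⊥-elim (All.lookup z∉ (Any-resp-⊆ xs⊆ (from (here refl))) refl)
⊆-unique-≡ {zs = z ∷ zs} (z∉ ∷ unique) (refl ∷ xs⊆) (refl ∷ ys⊆) to from =
  cong (z ∷_) (⊆-unique-≡ unique xs⊆ ys⊆ (dropHead xs⊆ to) (dropHead ys⊆ from))
  where
  dropHead : ∀ {us vs x} → us ⊆ zs → (x ∈ z ∷ us → x ∈ z ∷ vs) → x ∈ us → x ∈ vs
  dropHead us⊆ to x∈ with to (there x∈)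
  ... | here refl = ⊥-elim (All.lookup z∉ (Any-resp-⊆ us⊆ x∈) refl)
  ... | there x∈′ = x∈′

applyUpTo-⊆ : ∀ {A : Set} (f : ℕ → A) {m n} → m ≤ n → applyUpTo f m ⊆ applyUpTo f n
applyUpTo-⊆ f {n = n} z≤n = []⊆-universal (applyUpTo f n)
applyUpTo-⊆ f (s≤s m≤n)   = refl ∷ applyUpTo-⊆ (f ∘ suc) m≤n

applyDownFrom-⊆ : ∀ {A : Set} (f : ℕ → A) {m n} → m ≤ n → applyDownFrom f m ⊆ applyDownFrom f n
applyDownFrom-⊆ f m≤n = go (≤⇒≤′ m≤n)
  where
  go : ∀ {m n} → m ≤′ n → applyDownFrom f m ⊆ applyDownFrom f n
  go ≤′-refl         = ⊆-refl
  go (≤′-step m≤′n) = f _ ∷ʳ go m≤′n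

cartesianProduct-⊆ : ∀ {A B : Set} {xs xs′ : List A} {ys ys′ : List B} →
                     xs ⊆ xs′ → ys ⊆ ys′ → cartesianProduct xs ys ⊆ cartesianProduct xs′ ys′
cartesianProduct-⊆ []                  ys⊆ = []
cartesianProduct-⊆ {ys′ = ys′} (x ∷ʳ xs⊆) ys⊆ = Sublist.++⁺ˡ (map (x ,_) ys′) (cartesianProduct-⊆ xs⊆ ys⊆)
cartesianProduct-⊆ (refl ∷ xs⊆)        ys⊆ = Sublist.++⁺ (Sublist.map⁺ (_ ,_) ys⊆) (cartesianProduct-⊆ xs⊆ ys⊆)

reverse-applyUpTo : ∀ {A : Set} (f : ℕ → A) n → reverse (applyUpTo f n) ≡ applyDownFrom f n
reverse-applyUpTo f zero    = refl
reverse-applyUpTo f (suc n) = trans (unfold-reverse (f 0) (applyUpTo (f ∘ suc) n))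
  (trans (cong (_++ [ f 0 ]) (reverse-applyUpTo (f ∘ suc) n)) (applyDownFrom-∷ʳ f n))

concatMap-cartesianProduct : ∀ {A B C : Set} (g : A × B → List C) xs ys →
  concatMap (λ x → concatMap (λ y → g (x , y)) ys) xs ≡ concatMap g (cartesianProduct xs ys)
concatMap-cartesianProduct g []       ys = refl
concatMap-cartesianProduct g (x ∷ xs) ys = sym (trans (concatMap-++ g (map (x ,_) ys) _)
  (cong₂ _++_ (concatMap-map g (x ,_) ys) (sym (concatMap-cartesianProduct g xs ys))))

concatMap-select : ∀ {A B : Set} (p : A → Bool) (f : A → B) xs →
                   concatMap (λ x → if p x then [ f x ] else []) xs ≡ map f (filterᵇ p xs)
concatMap-select p f []       = refl
concatMap-select p f (x ∷ xs) with p x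
... | true  = cong (f x ∷_) (concatMap-select p f xs)
... | false = concatMap-select p f xs

≤-maxList : ∀ {x xs} → x ∈ xs → x ≤ maxList xs
≤-maxList {xs = y ∷ ys} (here refl) = m≤m⊔n y (maxList ys)
≤-maxList {xs = y ∷ ys} (there x∈)  = ≤-trans (≤-maxList x∈) (m≤n⊔m y (maxList ys))

maxList-≤ : ∀ {m xs} → All (_≤ m) xs → maxList xs ≤ m
maxList-≤ = foldr-preservesᵇ ⊔-lub z≤n

letter : Box → ℕ
letter (i , j) = i + j ∸ 1

open Subwords letter

maxRow maxCol : PipeDream → ℕ
maxRow D = maxList (map proj₁ D)
maxCol D = maxList (map proj₂ D)

grid : ℕ → ℕ → List Box
grid R C = cartesianProduct (applyUpTo suc R) (applyDownFrom suc C)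

readingOrder : PipeDream → List Box
readingOrder D = filterᵇ (λ b → memb b D) (grid (maxRow D) (maxCol D))

memb⁺ : ∀ {b} D → b ∈ D → T (memb b D)
memb⁺ {b} (d ∷ D) b∈ with ≡-dec _≟_ _≟_ b d
... | yes _ = tt
memb⁺ {b} (d ∷ D) (here b≡d) | no b≢d = ⊥-elim (b≢d b≡d)
memb⁺ {b} (d ∷ D) (there b∈) | no _   = memb⁺ D b∈

memb⁻ : ∀ {b} D → T (memb b D) → b ∈ D
memb⁻ {b} (d ∷ D) t with ≡-dec _≟_ _≟_ b d
... | yes b≡d = here b≡d
... | no _    = there (memb⁻ D t)

word≡letters-readingOrder : ∀ D → word D ≡ letters (readingOrder D)
word≡letters-readingOrder D = begin
  word D
    ≡⟨ concatMap-cartesianProduct cross (range1 (maxRow D)) (reverse (range1 (maxCol D))) ⟩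
  concatMap cross (cartesianProduct (range1 (maxRow D)) (reverse (range1 (maxCol D))))
    ≡⟨ cong₂ (λ rows cols → concatMap cross (cartesianProduct rows cols))
             (map-applyUpTo id suc (maxRow D))
             (trans (cong reverse (map-applyUpTo id suc (maxCol D))) (reverse-applyUpTo suc (maxCol D))) ⟩
  concatMap cross (grid (maxRow D) (maxCol D))
    ≡⟨ concatMap-select (λ b → memb b D) letter (grid (maxRow D) (maxCol D)) ⟩
  letters (readingOrder D) ∎
  where
  open ≡-Reasoning
  cross : Box → List ℕ
  cross b = if memb b D then [ letter b ] else []

grid-unique : ∀ R C → Unique (grid R C)
grid-unique R C = Unique.cartesianProduct⁺ (Unique.applyUpTo⁺₁ suc R (λ i<j _ → <⇒≢ (s≤s i<j)))
                                           (Unique.applyDownFrom⁺₁ suc C (λ j<i _ → >⇒≢ (s≤s j<i)))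

grid-⊆ : ∀ {R R′ C C′} → R ≤ R′ → C ≤ C′ → grid R C ⊆ grid R′ C′
grid-⊆ R≤R′ C≤C′ = cartesianProduct-⊆ (applyUpTo-⊆ suc R≤R′) (applyDownFrom-⊆ suc C≤C′)

∈-grid : ∀ {R C i j} → 1 ≤ i → i ≤ R → 1 ≤ j → j ≤ C → (i , j) ∈ grid R C
∈-grid (s≤s z≤n) i≤R (s≤s z≤n) j≤C = ∈-cartesianProduct⁺ (∈-applyUpTo⁺ suc i≤R) (∈-applyDownFrom⁺ suc j≤C)

∈-readingOrder⁺ : ∀ {D b} → WF D → b ∈ D → b ∈ readingOrder D
∈-readingOrder⁺ {D} wf b∈ =
  ∈-filter⁺ (T? ∘ (λ b → memb b D))
    (∈-grid (proj₁ (All.lookup wf b∈)) (≤-maxList (∈-map⁺ proj₁ b∈)) (proj₂ (All.lookup wf b∈)) (≤-maxList (∈-map⁺ proj₂ b∈)))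
    (memb⁺ D b∈)

∈-readingOrder⁻ : ∀ D {b} → b ∈ readingOrder D → b ∈ D
∈-readingOrder⁻ D b∈ = memb⁻ D (proj₂ (∈-filter⁻ (T? ∘ (λ b → memb b D)) {xs = grid (maxRow D) (maxCol D)} b∈))

WF-⊆-readingOrder : ∀ {P S} → WF P → S ⊆ readingOrder P → WF S
WF-⊆-readingOrder {P} wf S⊆ = All.tabulate (All.lookup wf ∘ ∈-readingOrder⁻ P ∘ Any-resp-⊆ S⊆)

readingOrder-sublist : ∀ {P S} → WF P → S ⊆ readingOrder P → readingOrder S ≡ S
readingOrder-sublist {P} {S} wf S⊆ =
  ⊆-unique-≡ (grid-unique (maxRow P) (maxCol P))
             (⊆-trans (filter-⊆ (T? ∘ (λ b → memb b S)) (grid (maxRow S) (maxCol S))) (grid-⊆ (bounded proj₁) (bounded proj₂)))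
             (⊆-trans S⊆ (filter-⊆ (T? ∘ (λ b → memb b P)) (grid (maxRow P) (maxCol P))))
             (∈-readingOrder⁻ S)
             (∈-readingOrder⁺ (WF-⊆-readingOrder wf S⊆))
  where
  bounded : ∀ (coord : Box → ℕ) → maxList (map coord S) ≤ maxList (map coord P)
  bounded coord = maxList-≤ (All.map⁺ (All.tabulate (≤-maxList ∘ ∈-map⁺ coord ∘ ∈-readingOrder⁻ P ∘ Any-resp-⊆ S⊆)))

letter-positive : ∀ {i j} → 1 ≤ i → 1 ≤ j → 1 ≤ letter (i , j)
letter-positive {suc i} {suc j} _ _ = ≤-trans (s≤s z≤n) (m≤n+m (suc j) i)

word-valid : ∀ {D} → WF D → All (Valid (demBound (word D))) (word D)
word-valid {D} wf = All.tabulate λ x∈ → positive x∈ , s≤s (≤-maxList x∈)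
  where
  positive : ∀ {x} → x ∈ word D → 1 ≤ x
  positive x∈ with ∈-map⁻ letter (subst (_ ∈_) (word≡letters-readingOrder D) x∈)
  ... | b , b∈ , refl = let 1≤i , 1≤j = All.lookup wf (∈-readingOrder⁻ D b∈) in letter-positive 1≤i 1≤j

δ≡⋆w : ∀ {D} → WF D → δ D ≡ id ⋆w word D
δ≡⋆w {D} wf = demazure≡⋆w (demBound (word D)) (word D) id (word-valid wf)

ascending⇒Reduced : ∀ {D} → WF D → Ascending id (word D) → Reduced D
ascending⇒Reduced {D} wf asc = sym (begin
  invCount B (δ D)                  ≡⟨ cong (invCount B) (trans (δ≡⋆w wf) (⋆w-ascending (word D) asc)) ⟩
  invCount B (id ·w word D)         ≡⟨ invCount-·w-ascending B (word D) (word-valid wf) asc ⟩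
  length (word D) + invCount B id   ≡⟨ cong (length (word D) +_) (invCount-id B) ⟩
  length (word D) + 0               ≡⟨ +-identityʳ _ ⟩
  length (word D)                   ∎)
  where
  open ≡-Reasoning
  B = demBound (word D)

reducedSubdreamThrough : ∀ {P c} → WF P → c ∈ P → Σ PipeDream λ D → WF D × Reduced D × (δ D ≗ δ P) × c ∈ D
reducedSubdreamThrough {P} wf c∈P
  with reducedSubwordThrough (demBound (word P)) (readingOrder P) (∈-readingOrder⁺ wf c∈P)
         (All.map⁻ (subst (All _) (word≡letters-readingOrder P) (word-valid wf)))
... | reducedSubword S S⊆ asc prod , c∈S =
  S , wfS , ascending⇒Reduced wfS (subst (Ascending id) (sym wordS) asc) , δS≗δP , c∈S
  where
  wfS = WF-⊆-readingOrder wf S⊆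
  wordS : word S ≡ letters S
  wordS = trans (word≡letters-readingOrder S) (cong letters (readingOrder-sublist wf S⊆))
  δS≗δP : δ S ≗ δ P
  δS≗δP n = begin
    δ S n                              ≡⟨ cong-app (trans (δ≡⋆w wfS) (cong (id ⋆w_) wordS)) n ⟩
    (id ⋆w letters S) n                ≡⟨ cong-app (⋆w-ascending (letters S) asc) n ⟩
    (id ·w letters S) n                ≡⟨ prod n ⟩
    (id ⋆w letters (readingOrder P)) n ≡⟨ cong-app (trans (δ≡⋆w wf) (cong (id ⋆w_) (word≡letters-readingOrder P))) n ⟨
    δ P n                              ∎
    where open ≡-Reasoning

lemma2p1 : ∀ {k l} (w : PartialPerm k l) (wt : SInf) → IsMinCompletion w wt →
           (P : PipeDream) → WF P → δ P ≗ fun wt →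
           ∀ {c} → c ∈ P →
           Σ PipeDream (λ D → WF D × Reduced D × (δ D ≗ fun wt) × c ∈ D)
lemma2p1 w wt _ P wf δP≗wt c∈P =
  let D , wfD , reduced , δD≗δP , c∈D = reducedSubdreamThrough wf c∈P
  in D , wfD , reduced , (λ n → trans (δD≗δP n) (δP≗wt n)) , c∈D
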